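{- For every $n\ge 5$ we have $g_N(n)=\left\lceil\frac{n(n-2)}{2}\right\rceil$.
   Context: A tree $T$ is hidden on a known vertex set $V$ with $|V|=n$. A distance query is an unordered pair of distinct vertices, answered by their distance in $T$. In a non-adaptive algorithm the set $Q$ of queried pairs (the query graph on $V$) is fixed in advance. A tree on $V$ is consistent with the answers if its distance between every pair in $Q$ equals the answer. $g_N(n)$ is the minimum of $|Q|$ over all query graphs $Q$ on $V$ such that for every tree $T$ on $V$, $T$ is the only tree on $V$ consistent with the answers of $T$ on $Q$. -}

module Defs where

open import Data.Nat using (ℕ; zero; suc; _+_; _*_; _∸_; _≤_; _<_; ⌈_/2⌉)
open import Data.Nat.Properties using (_<?_)
open import Data.Fin using (Fin; toℕ)
open import Data.Bool using (Bool; true; false; if_then_else_)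
open import Data.List using (List; []; _∷_; _++_; [_]; length; map; allFin)
open import Data.Nat.ListAction using (sum)
open import Data.List.Relation.Unary.Unique.Propositional using (Unique)
open import Data.Product using (Σ; _×_; ∃; ∃-syntax)
open import Data.Unit using (⊤)
open import Data.Empty using (⊥)
open import Relation.Binary.PropositionalEquality using (_≡_)
open import Relation.Nullary using (¬_; does)

record SimpleGraph (n : ℕ) : Set where
  field
    adj    : Fin n → Fin n → Bool
    sym    : ∀ u v → adj u v ≡ adj v u
    irrefl : ∀ u → adj u u ≡ false
open SimpleGraph public

edgeCount : ∀ {n} → SimpleGraph n → ℕ
edgeCount {n} G =
  sum (map (λ u → sum (map (λ v →
        if does (toℕ u <? toℕ v) then (if adj G u v then 1 else 0) else 0)
      (allFin n))) (allFin n))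

data Walk {n} (G : SimpleGraph n) : Fin n → Fin n → ℕ → Set where
  here : ∀ {u} → Walk G u u 0
  step : ∀ {u w v k} → adj G u w ≡ true → Walk G w v k → Walk G u v (suc k)

Dist : ∀ {n} → SimpleGraph n → Fin n → Fin n → ℕ → Set
Dist G u v d = Walk G u v d × (∀ k → Walk G u v k → d ≤ k)

Connected : ∀ {n} → SimpleGraph n → Set
Connected G = ∀ u v → ∃[ k ] Walk G u v k

Chain : ∀ {n} → SimpleGraph n → List (Fin n) → Set
Chain G []           = ⊤
Chain G (x ∷ [])     = ⊤
Chain G (x ∷ y ∷ xs) = adj G x y ≡ true × Chain G (y ∷ xs)

IsCycle : ∀ {n} → SimpleGraph n → List (Fin n) → Set
IsCycle G []       = ⊥
IsCycle G (x ∷ xs) = 3 ≤ length (x ∷ xs) × Unique (x ∷ xs) × Chain G ((x ∷ xs) ++ [ x ])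

Acyclic : ∀ {n} → SimpleGraph n → Set
Acyclic G = ¬ (∃[ vs ] IsCycle G vs)

IsTree : ∀ {n} → SimpleGraph n → Set
IsTree G = Connected G × Acyclic G

SameEdges : ∀ {n} → SimpleGraph n → SimpleGraph n → Set
SameEdges T T' = ∀ u v → adj T u v ≡ adj T' u v

Consistent : ∀ {n} → SimpleGraph n → SimpleGraph n → SimpleGraph n → Set
Consistent Q T T' = ∀ u v → adj Q u v ≡ true → ∀ d → Dist T u v d → Dist T' u v d

-- Q determines every tree non-adaptively.
Identifying : ∀ {n} → SimpleGraph n → Set
Identifying {n} Q = (T T' : SimpleGraph n) → IsTree T → IsTree T' →
                    Consistent Q T T' → SameEdges T T'

{-# OPTIONS --safe #-}
module Submission where

-- If some vertex u of an identifying query graph Q were unqueried with two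
-- vertices v and w, pick a fourth vertex c and let T_v and T_w be the star centred at c with the
-- leaf u moved to hang from v, resp. from w. Off u the two trees coincide and u is a leaf of both,
-- so they agree on distances avoiding u; the transposition of v and w fixes u and maps T_v onto
-- T_w, so they also agree on d(u, b) for b ∉ {v, w}. Thus Q cannot tell T_v from T_w. Hence every
-- vertex has Q-degree at least n − 2, and counting degrees gives |Q| ≥ n(n − 2)/2.
--
-- Query all pairs except those of a maximum matching. Distance-1 answers fix every
-- unmatched edge. If a matched pair ab were an edge of T but not of T′, the distance-2 answers
-- through the T′-neighbour p of a on the way to b force a 4-cycle a p y b with py matched, all of
-- whose edges but py lie in T and all but ab in T′. For n ≥ 5 some vertex x outside this square
-- hangs from a corner s in T; then d(x, s′) = 2 in one tree but not in the other, where s′ is the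
-- corner matched with s.

open import Defs hiding (sym)
open import Data.Bool using (Bool; true; false; if_then_else_)
open import Data.Bool.Properties using (¬-not) renaming (_≟_ to _≟ᵇ_)
open import Data.Empty using (⊥; ⊥-elim)
open import Data.Fin using (Fin; zero; suc; toℕ; punchIn; fromℕ; fromℕ<; _≟_)
open import Data.Fin.Permutation using (Permutation′; _⟨$⟩ʳ_; _⟨$⟩ˡ_; inverseˡ; inverseʳ)
import Data.Fin.Permutation as Permutation
open import Data.Fin.Permutation.Components using (transpose; transpose-inverse)
open import Data.Fin.Properties
  using ( toℕ-injective; toℕ<n; toℕ-fromℕ; toℕ-fromℕ<; any?; injective⇒≤
        ; punchIn-injective; punchInᵢ≢i; punchIn-punchOut )
open import Data.List using (List; []; _∷_; _++_; [_]; allFin; map; tabulate; length; lookup)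
open import Data.List.Membership.Propositional using (_∈_; _∉_)
open import Data.List.Membership.Propositional.Properties using (∈-++⁺ʳ)
open import Data.List.Properties using (map-tabulate)
open import Data.List.Relation.Unary.All using (All; []; _∷_) renaming (lookup to All-lookup)
open import Data.List.Relation.Unary.AllPairs using ([]; _∷_) renaming (head to AllPairs-head)
open import Data.List.Relation.Unary.Any using (here; there)
import Data.List.Relation.Unary.Any as Any
open import Data.List.Relation.Unary.Any.Properties using (lookup-index)
open import Data.List.Relation.Unary.Linked using (Linked; [-]; _∷_)
open import Data.List.Relation.Unary.Linked.Properties using (Linked⇒AllPairs)
open import Data.List.Relation.Unary.Unique.Propositional using (Unique)
open import Data.List.Relation.Unary.Unique.Propositional.Properties using (take⁺)
open import Data.Nat using (ℕ; zero; suc; _+_; _*_; _∸_; _≤_; _<_; _>_; z≤n; s≤s; ⌈_/2⌉; ⌊_/2⌋)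
open import Data.Nat.ListAction using (sum)
open import Data.Nat.Properties renaming (_≟_ to _≟ℕ_)
open import Data.Product using (Σ; _,_; _×_; proj₁; proj₂; ∃; ∃-syntax)
open import Data.Sum using (_⊎_; inj₁; inj₂; [_,_]′) renaming (swap to ⊎-swap)
open import Data.Unit using (⊤; tt)
open import Function using (_∘_; id; _on_; flip)
open import Function.Bundles using (mk⇔)
open import Relation.Binary.Definitions using (tri<; tri≈; tri>)
open import Relation.Binary.PropositionalEquality hiding ([_])
open import Relation.Nullary using (yes; no; does; proof; Dec; ¬_; contradiction; Reflects; invert)
open import Relation.Nullary.Decidable
  using (dec-true; dec-false; _×-dec_; _⊎-dec_; ¬?; does-⇔; decidable-stable)
open import Relation.Unary using (Decidable)

open import Algebra.Properties.CommutativeMonoid.Sum +-0-commutativeMonoid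
  using (sum-syntax; ∑-distrib-+; ∑-comm; sum-cong-≗; sum-remove)

-- Counting on finite sets

∑-mono-≤ : ∀ {n} {f g : Fin n → ℕ} → (∀ i → f i ≤ g i) → ∑[ i < n ] f i ≤ ∑[ i < n ] g i
∑-mono-≤ {zero}  f≤g = z≤n
∑-mono-≤ {suc n} f≤g = +-mono-≤ (f≤g zero) (∑-mono-≤ (f≤g ∘ suc))

∑-const : ∀ n k → ∑[ i < n ] k ≡ n * k
∑-const zero    k = refl
∑-const (suc n) k = cong (k +_) (∑-const n k)

sum-tabulate : ∀ {n} (f : Fin n → ℕ) → sum (tabulate f) ≡ ∑[ i < n ] f i
sum-tabulate {zero}  f = refl
sum-tabulate {suc n} f = cong (f zero +_) (sum-tabulate (f ∘ suc))

sum-map-allFin : ∀ {n} (f : Fin n → ℕ) → sum (map f (allFin n)) ≡ ∑[ i < n ] f i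
sum-map-allFin f = trans (cong sum (map-tabulate id f)) (sum-tabulate f)

indicator : Bool → ℕ
indicator b = if b then 1 else 0

indicator≤1 : ∀ b → indicator b ≤ 1
indicator≤1 true  = ≤-refl
indicator≤1 false = z≤n

count : ∀ {n} → (Fin n → Bool) → ℕ
count {n} f = ∑[ i < n ] indicator (f i)

module _ {n} {f : Fin n → Bool} where

  count≤n : count f ≤ n
  count≤n = ≤-trans (∑-mono-≤ (indicator≤1 ∘ f)) (≤-reflexive (trans (∑-const n 1) (*-identityʳ n)))

  count-true : (∀ i → f i ≡ true) → count f ≡ n
  count-true f≡true =
    trans (sum-cong-≗ (cong indicator ∘ f≡true)) (trans (∑-const n 1) (*-identityʳ n))

  count-false : (∀ i → f i ≡ false) → count f ≡ 0
  count-false f≡false =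
    trans (sum-cong-≗ (cong indicator ∘ f≡false)) (trans (∑-const n 0) (*-zeroʳ n))

module _ {n} (f : Fin (suc n) → Bool) where

  count-punchIn : ∀ i → count f ≡ indicator (f i) + count (f ∘ punchIn i)
  count-punchIn i = sum-remove {i = i} (indicator ∘ f)

  count-false-punchIn : ∀ {i} → f i ≡ false → count f ≡ count (f ∘ punchIn i)
  count-false-punchIn {i} fi≡false =
    trans (count-punchIn i) (cong (λ b → indicator b + count (f ∘ punchIn i)) fi≡false)

  count≥punchIn : ∀ i → count (f ∘ punchIn i) ≤ count f
  count≥punchIn i =
    ≤-trans (m≤n+m (count (f ∘ punchIn i)) (indicator (f i))) (≤-reflexive (sym (count-punchIn i)))

count≤∸1 : ∀ {n} (f : Fin n → Bool) {i} → f i ≡ false → count f ≤ n ∸ 1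
count≤∸1 {suc n} f {i} fi≡false =
  ≤-trans (≤-reflexive (count-false-punchIn f {i} fi≡false)) (count≤n {f = f ∘ punchIn i})

count≤∸2 : ∀ {n} (f : Fin n → Bool) {i j} → i ≢ j → f i ≡ false → f j ≡ false → count f ≤ n ∸ 2
count≤∸2 {suc n} f {i} i≢j fi≡false fj≡false =
  ≤-trans (≤-reflexive (count-false-punchIn f {i} fi≡false))
          (count≤∸1 (f ∘ punchIn i) (trans (cong f (punchIn-punchOut i≢j)) fj≡false))

count≥∸1 : ∀ {n} (f : Fin n → Bool) → (∀ {i j} → f i ≡ false → f j ≡ false → i ≡ j) →
           n ∸ 1 ≤ count f
count≥∸1 {zero} _ _ = z≤n
count≥∸1 {suc n} f false-unique with any? (λ i → f i ≟ᵇ false)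
... | no ∄false = ≤-trans (n≤1+n n) (≤-reflexive (sym (count-true λ i → ¬-not (∄false ∘ (i ,_)))))
... | yes (i , fi≡false) = ≤-trans (≤-reflexive (sym (count-true true-elsewhere))) (count≥punchIn f i)
  where
  true-elsewhere : ∀ j → f (punchIn i j) ≡ true
  true-elsewhere j = ¬-not (punchInᵢ≢i i j ∘ sym ∘ false-unique fi≡false)

count≥∸2 : ∀ {n} (f : Fin (suc n) → Bool) i →
           (∀ {j k} → j ≢ i → k ≢ i → f j ≡ false → f k ≡ false → j ≡ k) → suc n ∸ 2 ≤ count f
count≥∸2 f i false-unique = ≤-trans (count≥∸1 (f ∘ punchIn i) false-unique′) (count≥punchIn f i)
  where
  false-unique′ : ∀ {j k} → f (punchIn i j) ≡ false → f (punchIn i k) ≡ false → j ≡ k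
  false-unique′ {j} {k} fj fk =
    punchIn-injective i j k (false-unique (punchInᵢ≢i i j) (punchInᵢ≢i i k) fj fk)

count-singleton : ∀ {n} (i : Fin (suc n)) → count (λ j → does (j ≟ i)) ≡ 1
count-singleton i rewrite count-punchIn (λ j → does (j ≟ i)) i | dec-true (i ≟ i) refl =
  cong suc (count-false λ j → dec-false (punchIn i j ≟ i) (punchInᵢ≢i i j))

module _ {n : ℕ} where

  open import Data.List.Membership.DecPropositional (_≟_ {n}) using (_∈?_)

  fresh : (xs : List (Fin n)) → length xs < n → ∃ (_∉ xs)
  fresh xs |xs|<n with any? (λ z → ¬? (z ∈? xs))
  ... | yes z∉xs = z∉xs
  ... | no ∄z∉xs = contradiction (injective⇒≤ index-injective) (<⇒≱ |xs|<n)
    where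
    member : ∀ z → z ∈ xs
    member z = decidable-stable (z ∈? xs) (∄z∉xs ∘ (z ,_))
    index-injective : ∀ {z z′} → Any.index (member z) ≡ Any.index (member z′) → z ≡ z′
    index-injective {z} {z′} eq =
      trans (lookup-index (member z)) (trans (cong (lookup xs) eq) (sym (lookup-index (member z′))))

Bool-≡-from-⇔ : ∀ {x y} → (x ≡ true → y ≡ true) → (y ≡ true → x ≡ true) → x ≡ y
Bool-≡-from-⇔ {false} {false} _ _ = refl
Bool-≡-from-⇔ {false} {true}  _ g = g refl
Bool-≡-from-⇔ {true}          f _ = sym (f refl)

transpose-matchˡ : ∀ {n} {i j : Fin n} → transpose i j i ≡ j
transpose-matchˡ {i = i} rewrite dec-true (i ≟ i) refl = refl

transpose-fixed : ∀ {n} {i j k : Fin n} → k ≢ i → k ≢ j → transpose i j k ≡ k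
transpose-fixed {i = i} {j} {k} k≢i k≢j rewrite dec-false (k ≟ i) k≢i | dec-false (k ≟ j) k≢j = refl

transpose-fixed⁻¹ : ∀ {n} {i j k m : Fin n} → m ≢ i → m ≢ j → transpose i j k ≡ m → k ≡ m
transpose-fixed⁻¹ {i = i} {j} {k} {m} m≢i m≢j eq = begin
  k                               ≡⟨ transpose-inverse j i ⟨
  transpose j i (transpose i j k) ≡⟨ cong (transpose j i) eq ⟩
  transpose j i m                 ≡⟨ transpose-fixed m≢j m≢i ⟩
  m                               ∎
  where open ≡-Reasoning

-- Graphs, walks and distances

Edge : ∀ {n} → SimpleGraph n → Fin n → Fin n → Set
Edge G x y = adj G x y ≡ true

degree : ∀ {n} → SimpleGraph n → Fin n → ℕ
degree G u = count (adj G u)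

module _ {n} (G : SimpleGraph n) where

  edge-sym : ∀ {x y} → Edge G x y → Edge G y x
  edge-sym {x} {y} e = trans (SimpleGraph.sym G y x) e

  edge⇒≢ : ∀ {x y} → Edge G x y → x ≢ y
  edge⇒≢ {x} e refl with () ← trans (sym e) (irrefl G x)

  non-edge : ∀ {x y} → adj G x y ≡ false → ¬ Edge G x y
  non-edge x≁y e with () ← trans (sym e) x≁y

  orderedEdge : Fin n → Fin n → ℕ
  orderedEdge u v = if does (toℕ u <? toℕ v) then indicator (adj G u v) else 0

  indicator-adj-split : ∀ u v → indicator (adj G u v) ≡ orderedEdge u v + orderedEdge v u
  indicator-adj-split u v with <-cmp (toℕ u) (toℕ v)
  ... | tri< u<v _ v≮u
    rewrite dec-true (toℕ u <? toℕ v) u<v | dec-false (toℕ v <? toℕ u) v≮u = sym (+-identityʳ _)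
  ... | tri> u≮v _ v<u
    rewrite dec-false (toℕ u <? toℕ v) u≮v | dec-true (toℕ v <? toℕ u) v<u =
    cong indicator (SimpleGraph.sym G u v)
  ... | tri≈ u≮u u≡v _ with refl ← toℕ-injective {i = u} {v} u≡v
    rewrite dec-false (toℕ u <? toℕ u) u≮u = cong indicator (irrefl G u)

  edgeCount-∑ : edgeCount G ≡ ∑[ u < n ] ∑[ v < n ] orderedEdge u v
  edgeCount-∑ = trans (sum-map-allFin (λ u → sum (map (orderedEdge u) (allFin n))))
                      (sum-cong-≗ λ u → sum-map-allFin (orderedEdge u))

  handshake : edgeCount G + edgeCount G ≡ ∑[ u < n ] degree G u
  handshake = begin
    edgeCount G + edgeCount G
      ≡⟨ cong₂ _+_ edgeCount-∑ (trans edgeCount-∑ (∑-comm orderedEdge)) ⟩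
    ∑[ u < n ] ∑[ v < n ] orderedEdge u v + ∑[ u < n ] ∑[ v < n ] orderedEdge v u
      ≡⟨ sym (∑-distrib-+ (λ u → ∑[ v < n ] orderedEdge u v) (λ u → ∑[ v < n ] orderedEdge v u)) ⟩
    ∑[ u < n ] (∑[ v < n ] orderedEdge u v + ∑[ v < n ] orderedEdge v u)
      ≡⟨ sum-cong-≗ (λ u → sym (∑-distrib-+ (orderedEdge u) (λ v → orderedEdge v u))) ⟩
    ∑[ u < n ] ∑[ v < n ] (orderedEdge u v + orderedEdge v u)
      ≡⟨ sum-cong-≗ (λ u → sum-cong-≗ (λ v → sym (indicator-adj-split u v))) ⟩
    ∑[ u < n ] degree G u ∎
    where open ≡-Reasoning

module _ {n} (R : Fin n → Fin n → Set) (R? : ∀ x y → Dec (R x y))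
         (R-sym : ∀ {x y} → R x y → R y x) (R-irrefl : ∀ {x} → ¬ R x x) where

  opaque

    relationGraph : SimpleGraph n
    relationGraph = record
      { adj    = λ x y → does (R? x y)
      ; sym    = λ x y → does-⇔ (mk⇔ R-sym R-sym) (R? x y) (R? y x)
      ; irrefl = λ x → dec-false (R? x x) R-irrefl
      }

    relationGraph-edge : ∀ {x y} → R x y → Edge relationGraph x y
    relationGraph-edge {x} {y} = dec-true (R? x y)

    relationGraph-non-edge : ∀ {x y} → ¬ R x y → adj relationGraph x y ≡ false
    relationGraph-non-edge {x} {y} = dec-false (R? x y)

    edge-relationGraph : ∀ {x y} → Edge relationGraph x y → R x y
    edge-relationGraph {x} {y} e = invert (subst (Reflects (R x y)) e (proof (R? x y)))

module _ {n} {G : SimpleGraph n} where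

  _++ʷ_ : ∀ {a b c k j} → Walk G a b k → Walk G b c j → Walk G a c (k + j)
  here       ++ʷ q = q
  step e p   ++ʷ q = step e (p ++ʷ q)

  walk-reverse : ∀ {a b k} → Walk G a b k → Walk G b a k
  walk-reverse here = here
  walk-reverse {k = suc k} (step e p) =
    subst (Walk G _ _) (+-comm k 1) (walk-reverse p ++ʷ step (edge-sym G e) here)

  walk₀⇒≡ : ∀ {a b} → Walk G a b 0 → a ≡ b
  walk₀⇒≡ here = refl

  Dist-sym : ∀ {a b d} → Dist G a b d → Dist G b a d
  Dist-sym (p , shortest) = walk-reverse p , λ k q → shortest k (walk-reverse q)

  Dist-functional : ∀ {a b d d′} → Dist G a b d → Dist G a b d′ → d ≡ d′
  Dist-functional (p , shortest) (p′ , shortest′) = ≤-antisym (shortest _ p′) (shortest′ _ p)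

module _ {n} (G : SimpleGraph n) where

  edge⇒Dist₁ : ∀ {a b} → Edge G a b → Dist G a b 1
  edge⇒Dist₁ {a} {b} e = step e here , shortest
    where
    shortest : ∀ k → Walk G a b k → 1 ≤ k
    shortest zero    p = contradiction (walk₀⇒≡ p) (edge⇒≢ G e)
    shortest (suc k) p = s≤s z≤n

  Dist₁⇒edge : ∀ {a b} → Dist G a b 1 → Edge G a b
  Dist₁⇒edge (step e here , _) = e

  walk? : ∀ k a b → Dec (Walk G a b k)
  walk? zero a b with a ≟ b
  ... | yes refl = yes here
  ... | no a≢b   = no (a≢b ∘ walk₀⇒≡)
  walk? (suc k) a b with any? (λ w → (adj G a w ≟ᵇ true) ×-dec walk? k w b)
  ... | yes (w , e , p) = yes (step e p)
  ... | no ∄w           = no λ { (step e p) → ∄w (_ , e , p) }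

  shortest-from : ∀ {a b} j r → (∀ i → i < j → ¬ Walk G a b i) → Walk G a b (j + r) → ∃ (Dist G a b)
  shortest-from {a} {b} j r none-below p with walk? j a b
  ... | yes pj = j , pj , λ k q → ≮⇒≥ λ k<j → none-below k k<j q
  shortest-from j zero    none-below p | no ¬pj =
    contradiction (subst (Walk G _ _) (+-identityʳ j) p) ¬pj
  shortest-from j (suc r) none-below p | no ¬pj =
    shortest-from (suc j) r none-below′ (subst (Walk G _ _) (+-suc j r) p)
    where
    none-below′ : ∀ i → i < suc j → ¬ Walk G _ _ i
    none-below′ i i<1+j with m≤n⇒m<n∨m≡n (≤-pred i<1+j)
    ... | inj₁ i<j  = none-below i i<j
    ... | inj₂ refl = ¬pj

  walk⇒Dist : ∀ {a b k} → Walk G a b k → ∃ (Dist G a b)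
  walk⇒Dist = shortest-from 0 _ (λ _ ())

  connected⇒Dist : Connected G → ∀ a b → ∃ (Dist G a b)
  connected⇒Dist connected a b = walk⇒Dist (proj₂ (connected a b))

  crossing-edge : (P : Fin n → Set) → Decidable P → ∀ {a b k} → Walk G a b k → ¬ P a → P b →
                  ∃[ x ] ∃[ y ] ¬ P x × P y × Edge G x y
  crossing-edge P P? here ¬Pa Pb = contradiction Pb ¬Pa
  crossing-edge P P? {a} (step {w = w} e p) ¬Pa Pb with P? w
  ... | yes Pw = a , w , ¬Pa , Pw , e
  ... | no ¬Pw = crossing-edge P P? p ¬Pw Pb

walk-map : ∀ {n} {G H : SimpleGraph n} (f : Fin n → Fin n) →
           (∀ {x y} → Edge G x y → Edge H (f x) (f y)) →
           ∀ {a b k} → Walk G a b k → Walk H (f a) (f b) k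
walk-map f f-edge here       = here
walk-map f f-edge (step e p) = step (f-edge e) (walk-map f f-edge p)

Dist-transport : ∀ {n} {G H : SimpleGraph n} (π : Permutation′ n) →
                 (∀ x y → adj H (π ⟨$⟩ʳ x) (π ⟨$⟩ʳ y) ≡ adj G x y) →
                 ∀ {a b d} → Dist G a b d → Dist H (π ⟨$⟩ʳ a) (π ⟨$⟩ʳ b) d
Dist-transport {G = G} {H} π π-adj {a} {b} (p , shortest) =
  walk-map (π ⟨$⟩ʳ_) (λ {x} {y} e → trans (π-adj x y) e) p ,
  λ k q → shortest k (subst₂ (λ x y → Walk G x y k) (inverseˡ π) (inverseˡ π) (walk-map (π ⟨$⟩ˡ_) back q))
  where
  back : ∀ {x y} → Edge H x y → Edge G (π ⟨$⟩ˡ x) (π ⟨$⟩ˡ y)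
  back e = trans (sym (π-adj _ _)) (subst₂ (Edge H) (sym (inverseʳ π)) (sym (inverseʳ π)) e)

Shortens : ∀ {n} → SimpleGraph n → SimpleGraph n → Fin n → Fin n → Set
Shortens G H a b = ∀ {k} → Walk G a b k → ∃[ k′ ] k′ ≤ k × Walk H a b k′

Dist-transfer : ∀ {n} {G H : SimpleGraph n} {a b d} → Shortens G H a b → Shortens H G a b →
                Dist G a b d → Dist H a b d
Dist-transfer {H = H} {a} {b} G⇒H H⇒G (p , shortest) with G⇒H p
... | k , k≤d , q with H⇒G q
...   | k′ , k′≤k , r = subst (Walk H a b) (≤-antisym k≤d (≤-trans (shortest k′ r) k′≤k)) q ,
                        λ j w → let (j′ , j′≤j , w′) = H⇒G w in ≤-trans (shortest j′ w′) j′≤j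

module _ {n} {G H : SimpleGraph n} {u t : Fin n}
         (leaf : ∀ {z} → Edge G u z → z ≡ t)
         (off-u : ∀ {x y} → x ≢ u → y ≢ u → Edge G x y → Edge H x y) where

  -- A walk entering the leaf u must leave it straight back to t, so the detour can be cut out.
  shortcut-leaf : ∀ {a b} → a ≢ u → b ≢ u → Shortens G H a b
  shortcut-leaf a≢u b≢u here = 0 , z≤n , here
  shortcut-leaf a≢u b≢u (step {w = w} e p) with w ≟ u
  ... | no w≢u =
    let (k , k≤ , q) = shortcut-leaf w≢u b≢u p in suc k , s≤s k≤ , step (off-u a≢u w≢u e) q
  ... | yes refl with p
  ...   | here = contradiction refl b≢u
  ...   | step e′ p′ with refl ← leaf e′ | refl ← leaf (edge-sym G e) =
    let (k , k≤ , q) = shortcut-leaf a≢u b≢u p′ in k , ≤-trans k≤ (m≤n+m _ 2) , q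

Dist-off-leaf : ∀ {n} {G H : SimpleGraph n} {u t t′} →
                (∀ {z} → Edge G u z → z ≡ t) → (∀ {z} → Edge H u z → z ≡ t′) →
                (∀ {x y} → x ≢ u → y ≢ u → adj G x y ≡ adj H x y) →
                ∀ {a b d} → a ≢ u → b ≢ u → Dist G a b d → Dist H a b d
Dist-off-leaf leafG leafH agree a≢u b≢u =
  Dist-transfer (shortcut-leaf leafG (λ x≢u y≢u e → trans (sym (agree x≢u y≢u)) e) a≢u b≢u)
                (shortcut-leaf leafH (λ x≢u y≢u e → trans (agree x≢u y≢u) e) a≢u b≢u)

consistent⇒edge : ∀ {n} {Q G H : SimpleGraph n} → Consistent Q G H →
                  ∀ {a b} → Edge Q a b → Edge G a b → Edge H a b
consistent⇒edge {G = G} {H} consistent {a} {b} ab∈Q e = Dist₁⇒edge H (consistent a b ab∈Q 1 (edge⇒Dist₁ G e))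

consistent-sym : ∀ {n} {Q G H : SimpleGraph n} → Connected G → Consistent Q G H → Consistent Q H G
consistent-sym {G = G} {H} connected consistent a b ab∈Q d D
  with d′ , D′ ← connected⇒Dist G connected a b =
  subst (Dist G a b) (Dist-functional (consistent a b ab∈Q d′ D′) D) D′

-- Cycles

NoBacktrack : ∀ {A : Set} → List A → Set
NoBacktrack (x ∷ y ∷ z ∷ r) = x ≢ z × NoBacktrack (y ∷ z ∷ r)
NoBacktrack _               = ⊤

LastStep : ∀ {A : Set} → (A → A → Set) → List A → Set
LastStep R (x ∷ y ∷ [])    = R x y
LastStep R (x ∷ y ∷ z ∷ r) = LastStep R (y ∷ z ∷ r)
LastStep R _               = ⊤

module _ {A : Set} {R : A → A → Set} where

  Linked⇒LastStep : ∀ {x y} r → Linked R (x ∷ y ∷ r) → LastStep R (x ∷ y ∷ r)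
  Linked⇒LastStep []      (Rxy ∷ [-]) = Rxy
  Linked⇒LastStep (z ∷ r) (_ ∷ Ryzr)  = Linked⇒LastStep r Ryzr

  LastStep-++ : ∀ {x y} zs {a b} → LastStep R (x ∷ y ∷ zs ++ a ∷ b ∷ []) → R a b
  LastStep-++ []       Rab = Rab
  LastStep-++ (z ∷ zs) Rab = LastStep-++ zs Rab

noBacktrack-wrap : ∀ {A : Set} {y z : A} l {a b} → Unique (y ∷ z ∷ l) →
                   All (a ≢_) (y ∷ z ∷ l) → All (b ≢_) (z ∷ l) →
                   NoBacktrack (y ∷ z ∷ l ++ a ∷ b ∷ [])
noBacktrack-wrap []      _                      (a≢y ∷ _) (b≢z ∷ _) = a≢y ∘ sym , b≢z ∘ sym , tt
noBacktrack-wrap (c ∷ l) ((_ ∷ y≢c ∷ _) ∷ uniq) (_ ∷ a∉) (_ ∷ b∉) = y≢c , noBacktrack-wrap l uniq a∉ b∉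

chain-snoc : ∀ {n} (G : SimpleGraph n) ys {a b} → Chain G (ys ++ [ a ]) → Edge G a b →
             Chain G (ys ++ a ∷ b ∷ [])
chain-snoc G []            _         e = e , tt
chain-snoc G (y ∷ [])      (e′ , _)  e = e′ , e , tt
chain-snoc G (y ∷ y′ ∷ ys) (e′ , ch) e = e′ , chain-snoc G (y′ ∷ ys) ch e

module Ranked {n} (G : SimpleGraph n) (h : Fin n → ℕ)
  (rank-≢ : ∀ {x y} → Edge G x y → h x ≢ h y)
  (lower-unique : ∀ {x y z} → Edge G x y → Edge G x z → h y < h x → h z < h x → y ≡ z) where

  rank-cmp : ∀ {x y} → Edge G x y → h x < h y ⊎ h y < h x
  rank-cmp {x} {y} e with <-cmp (h x) (h y)
  ... | tri< x<y _ _ = inj₁ x<y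
  ... | tri≈ _ x≡y _ = contradiction x≡y (rank-≢ e)
  ... | tri> _ _ y<x = inj₂ y<x

  ascends-forever : ∀ {x y} r → Chain G (x ∷ y ∷ r) → NoBacktrack (x ∷ y ∷ r) → h x < h y →
                    Linked (_<_ on h) (x ∷ y ∷ r)
  ascends-forever []      _                _           x<y = x<y ∷ [-]
  ascends-forever (z ∷ r) (exy , eyz , ch) (x≢z , nb) x<y with rank-cmp eyz
  ... | inj₁ y<z = x<y ∷ ascends-forever r (eyz , ch) nb y<z
  ... | inj₂ z<y = contradiction (lower-unique (edge-sym G exy) eyz x<y z<y) x≢z

  descends⊎ends-ascending : ∀ {x y} r → Chain G (x ∷ y ∷ r) → NoBacktrack (x ∷ y ∷ r) →
                            Linked (_>_ on h) (x ∷ y ∷ r) ⊎ LastStep (_<_ on h) (x ∷ y ∷ r)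
  descends⊎ends-ascending [] (exy , _) _ with rank-cmp exy
  ... | inj₁ x<y = inj₂ x<y
  ... | inj₂ y<x = inj₁ (y<x ∷ [-])
  descends⊎ends-ascending (z ∷ r) (exy , ch) (x≢z , nb) with descends⊎ends-ascending r ch nb
  ... | inj₂ ends-ascending = inj₂ ends-ascending
  ... | inj₁ descends with rank-cmp exy
  ...   | inj₁ x<y = inj₂ (Linked⇒LastStep (z ∷ r) (ascends-forever (z ∷ r) (exy , ch) (x≢z , nb) x<y))
  ...   | inj₂ y<x = inj₁ (y<x ∷ descends)

  -- Run around the cycle x₀ x₁ … x₀ x₁: it either descends all the way, or its last step
  -- x₀ x₁ ascends and then so does everything; either way x₀ ends up ranked against itself.
  acyclic : Acyclic G
  acyclic ([] , ())
  acyclic (_ ∷ [] , s≤s () , _)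
  acyclic (_ ∷ _ ∷ [] , s≤s (s≤s ()) , _)
  acyclic (x₀ ∷ x₁ ∷ x₂ ∷ r , _ , (x₀∉ ∷ x₁∉ ∷ uniq) , e₀₁ , cycle) =
    <-irrefl refl (x₀-below-itself (descends⊎ends-ascending rest chain noBacktrack))
    where
    rest = x₂ ∷ r ++ x₀ ∷ x₁ ∷ []
    chain : Chain G (x₀ ∷ x₁ ∷ rest)
    chain = e₀₁ , chain-snoc G (x₁ ∷ x₂ ∷ r) cycle e₀₁
    noBacktrack : NoBacktrack (x₀ ∷ x₁ ∷ rest)
    noBacktrack = All-lookup x₀∉ (there (here refl)) , noBacktrack-wrap r (x₁∉ ∷ uniq) x₀∉ x₁∉
    x₀-again : x₀ ∈ x₁ ∷ rest
    x₀-again = there (there (∈-++⁺ʳ r (here refl)))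
    x₀-below-itself : Linked (_>_ on h) (x₀ ∷ x₁ ∷ rest) ⊎ LastStep (_<_ on h) (x₀ ∷ x₁ ∷ rest) →
                      h x₀ < h x₀
    x₀-below-itself (inj₁ descends) =
      All-lookup (AllPairs-head (Linked⇒AllPairs (flip <-trans) descends)) x₀-again
    x₀-below-itself (inj₂ ends-ascending) =
      All-lookup (AllPairs-head (Linked⇒AllPairs <-trans ascends)) x₀-again
      where
      ascends = ascends-forever rest chain noBacktrack
                                (LastStep-++ {R = _<_ on h} {x₀} {x₁} (x₂ ∷ r) ends-ascending)

module _ {n} {G : SimpleGraph n} (acyclic : Acyclic G) where

  no-triangle : ∀ {a b c} → Unique (a ∷ b ∷ c ∷ []) →
                Edge G a b → Edge G b c → Edge G c a → ⊥
  no-triangle uniq eab ebc eca = acyclic (_ , s≤s (s≤s (s≤s z≤n)) , uniq , eab , ebc , eca , tt)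

  no-quadrangle : ∀ {a b c d} → Unique (a ∷ b ∷ c ∷ d ∷ []) →
                  Edge G a b → Edge G b c → Edge G c d → Edge G d a → ⊥
  no-quadrangle uniq eab ebc ecd eda = acyclic (_ , s≤s (s≤s (s≤s z≤n)) , uniq , eab , ebc , ecd , eda , tt)

  path₂⇒Dist₂ : ∀ {x y z} → x ≢ z → Edge G x y → Edge G y z → Dist G x z 2
  path₂⇒Dist₂ {x} {y} {z} x≢z exy eyz = step exy (step eyz here) , shortest
    where
    shortest : ∀ k → Walk G x z k → 2 ≤ k
    shortest zero          p                = contradiction (walk₀⇒≡ p) x≢z
    shortest (suc zero)    (step exz here)  =
      ⊥-elim (no-triangle ((edge⇒≢ G exy ∷ x≢z ∷ []) ∷ (edge⇒≢ G eyz ∷ []) ∷ [] ∷ [])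
                          exy eyz (edge-sym G exz))
    shortest (suc (suc k)) _                = s≤s (s≤s z≤n)

  -- Along the path x a p q b, the only way back from b to x in two steps would close a cycle.
  path₄⇒¬Dist₂ : ∀ {x a p q b} → Unique (x ∷ a ∷ p ∷ q ∷ b ∷ []) →
                 Edge G x a → Edge G a p → Edge G p q → Edge G q b → adj G a b ≡ false → ¬ Dist G x b 2
  path₄⇒¬Dist₂ {a = a} {p} {q} {b} uniq exa eap epq eqb a≁b (step {w = y} exy (step eyb here) , shortest)
    with y ≟ a | y ≟ p | y ≟ q | y ≟ b
  ... | yes refl | _        | _        | _        = non-edge G a≁b eyb
  ... | _        | yes refl | _        | _        = no-triangle (take⁺ 3 uniq) exa eap (edge-sym G exy)
  ... | _        | _        | yes refl | _        = no-quadrangle (take⁺ 4 uniq) exa eap epq (edge-sym G exy)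
  ... | _        | _        | _        | yes refl = <-irrefl refl (shortest 1 (step exy here))
  ... | no y≢a   | no y≢p   | no y≢q   | no y≢b   =
    acyclic (_ , s≤s (s≤s (s≤s z≤n)) , (y∉ ∷ uniq)
            , edge-sym G exy , exa , eap , epq , eqb , edge-sym G eyb , tt)
    where y∉ = edge⇒≢ G (edge-sym G exy) ∷ y≢a ∷ y≢p ∷ y≢q ∷ y≢b ∷ []

-- Lower bound

-- The star centred at c in which the leaf u hangs from t instead of from c.
module _ {n} (c u : Fin n) where

  data Parent (t : Fin n) : Fin n → Fin n → Set where
    u↑t : Parent t u t
    x↑c : ∀ {x} → x ≢ u → x ≢ c → Parent t x c

  parent? : ∀ t x y → Dec (Parent t x y)
  parent? t x y with x ≟ u
  parent? t x y | yes refl with y ≟ t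
  ... | yes refl = yes u↑t
  ... | no y≢t   = no λ { u↑t → y≢t refl ; (x↑c u≢u _) → u≢u refl }
  parent? t x y | no x≢u with x ≟ c | y ≟ c
  ... | yes x≡c | _        = no λ { u↑t → x≢u refl ; (x↑c _ x≢c) → x≢c x≡c }
  ... | no x≢c  | yes refl = yes (x↑c x≢u x≢c)
  ... | no _    | no y≢c   = no λ { u↑t → x≢u refl ; (x↑c _ _) → y≢c refl }

  Link : Fin n → Fin n → Fin n → Set
  Link t x y = Parent t x y ⊎ Parent t y x

  link? : ∀ t x y → Dec (Link t x y)
  link? t x y = parent? t x y ⊎-dec parent? t y x

  parent-irrefl : ∀ {t x} → t ≢ u → ¬ Parent t x x
  parent-irrefl u≢u u↑t         = u≢u refl
  parent-irrefl _   (x↑c _ c≢c) = c≢c refl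

  link-irrefl : ∀ {t x} → t ≢ u → ¬ Link t x x
  link-irrefl t≢u = [ parent-irrefl t≢u , parent-irrefl t≢u ]′

  pendantStar : ∀ t → t ≢ u → SimpleGraph n
  pendantStar t t≢u = relationGraph (Link t) (link? t) ⊎-swap (link-irrefl t≢u)

  parent-off-u : ∀ {t t′ x y} → x ≢ u → Parent t x y → Parent t′ x y
  parent-off-u u≢u u↑t           = contradiction refl u≢u
  parent-off-u _   (x↑c x≢u x≢c) = x↑c x≢u x≢c

  link-off-u : ∀ {t t′ x y} → x ≢ u → y ≢ u → Link t x y → Link t′ x y
  link-off-u x≢u y≢u (inj₁ p) = inj₁ (parent-off-u x≢u p)
  link-off-u x≢u y≢u (inj₂ p) = inj₂ (parent-off-u y≢u p)

  module _ {v w} (v≢u : v ≢ u) (w≢u : w ≢ u) (v≢c : v ≢ c) (w≢c : w ≢ c) where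

    parent-transpose : ∀ {x y} → Parent v x y → Parent w (transpose v w x) (transpose v w y)
    parent-transpose u↑t
      rewrite transpose-fixed {i = v} {w} (v≢u ∘ sym) (w≢u ∘ sym) | transpose-matchˡ {i = v} {w} = u↑t
    parent-transpose (x↑c x≢u x≢c)
      rewrite transpose-fixed {i = v} {w} (v≢c ∘ sym) (w≢c ∘ sym) =
      x↑c (x≢u ∘ transpose-fixed⁻¹ (v≢u ∘ sym) (w≢u ∘ sym)) (x≢c ∘ transpose-fixed⁻¹ (v≢c ∘ sym) (w≢c ∘ sym))

    link-transpose : ∀ {x y} → Link v x y → Link w (transpose v w x) (transpose v w y)
    link-transpose (inj₁ p) = inj₁ (parent-transpose p)
    link-transpose (inj₂ p) = inj₂ (parent-transpose p)

  module PendantStar {t} (t≢u : t ≢ u) (t≢c : t ≢ c) (u≢c : u ≢ c) where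

    T : SimpleGraph n
    T = pendantStar t t≢u

    link : ∀ {x y} → Edge T x y → Link t x y
    link = edge-relationGraph (Link t) (link? t) ⊎-swap (link-irrefl t≢u)

    link-edge : ∀ {x y} → Link t x y → Edge T x y
    link-edge = relationGraph-edge (Link t) (link? t) ⊎-swap (link-irrefl t≢u)

    depth : Fin n → ℕ
    depth x = if does (x ≟ c) then 0 else if does (x ≟ u) then 2 else 1

    depth-c : depth c ≡ 0
    depth-c rewrite dec-true (c ≟ c) refl = refl

    depth-u : depth u ≡ 2
    depth-u rewrite dec-false (u ≟ c) u≢c | dec-true (u ≟ u) refl = refl

    depth-other : ∀ {x} → x ≢ c → x ≢ u → depth x ≡ 1
    depth-other {x} x≢c x≢u rewrite dec-false (x ≟ c) x≢c | dec-false (x ≟ u) x≢u = refl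

    parent-deeper : ∀ {x y} → Parent t x y → depth y < depth x
    parent-deeper u↑t           rewrite depth-u | depth-other t≢c t≢u = s≤s (s≤s z≤n)
    parent-deeper (x↑c x≢u x≢c) rewrite depth-c | depth-other x≢c x≢u = s≤s z≤n

    parent-functional : ∀ {x y z} → Parent t x y → Parent t x z → y ≡ z
    parent-functional u↑t           u↑t           = refl
    parent-functional u↑t           (x↑c u≢u _)   = contradiction refl u≢u
    parent-functional (x↑c u≢u _)   u↑t           = contradiction refl u≢u
    parent-functional (x↑c _ _)     (x↑c _ _)     = refl

    lower-link⇒parent : ∀ {x y} → Link t x y → depth y < depth x → Parent t x y
    lower-link⇒parent (inj₁ p) _   = p
    lower-link⇒parent (inj₂ p) y<x = contradiction (parent-deeper p) (<-asym y<x)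

    acyclic : Acyclic T
    acyclic = Ranked.acyclic T depth depth-≢ lower-unique
      where
      depth-≢ : ∀ {x y} → Edge T x y → depth x ≢ depth y
      depth-≢ e with link e
      ... | inj₁ p = ≢-sym (<⇒≢ (parent-deeper p))
      ... | inj₂ p = <⇒≢ (parent-deeper p)
      lower-unique : ∀ {x y z} → Edge T x y → Edge T x z → depth y < depth x → depth z < depth x → y ≡ z
      lower-unique exy exz y<x z<x =
        parent-functional (lower-link⇒parent (link exy) y<x) (lower-link⇒parent (link exz) z<x)

    walk-to-centre : ∀ x → ∃ (Walk T x c)
    walk-to-centre x with x ≟ c | x ≟ u
    ... | yes refl | _        = 0 , here
    ... | no x≢c   | yes refl = 2 , step (link-edge (inj₁ u↑t)) (step (link-edge (inj₁ (x↑c t≢u t≢c))) here)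
    ... | no x≢c   | no x≢u   = 1 , step (link-edge (inj₁ (x↑c x≢u x≢c))) here

    connected : Connected T
    connected x y = _ , proj₂ (walk-to-centre x) ++ʷ walk-reverse (proj₂ (walk-to-centre y))

    isTree : IsTree T
    isTree = connected , acyclic

    u-leaf : ∀ {z} → Edge T u z → z ≡ t
    u-leaf e with link e
    ... | inj₁ u↑t         = refl
    ... | inj₁ (x↑c u≢u _) = contradiction refl u≢u
    ... | inj₂ u↑t         = contradiction refl t≢u
    ... | inj₂ (x↑c _ _)   = contradiction refl u≢c

module _ {n} {c u v w : Fin n} (v≢u : v ≢ u) (w≢u : w ≢ u) (v≢c : v ≢ c) (w≢c : w ≢ c) (u≢c : u ≢ c) where

  private
    module Tv = PendantStar c u v≢u v≢c u≢c
    module Tw = PendantStar c u w≢u w≢c u≢c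

  pendantStars-agree-off-u : ∀ {x y} → x ≢ u → y ≢ u → adj Tv.T x y ≡ adj Tw.T x y
  pendantStars-agree-off-u x≢u y≢u =
    Bool-≡-from-⇔ (Tw.link-edge ∘ link-off-u c u x≢u y≢u ∘ Tv.link)
                  (Tv.link-edge ∘ link-off-u c u x≢u y≢u ∘ Tw.link)

  pendantStars-transpose : ∀ x y → adj Tw.T (transpose v w x) (transpose v w y) ≡ adj Tv.T x y
  pendantStars-transpose x y =
    Bool-≡-from-⇔ (Tv.link-edge ∘ back ∘ Tw.link)
                  (Tw.link-edge ∘ link-transpose c u v≢u w≢u v≢c w≢c ∘ Tv.link)
    where
    back : Link c u w (transpose v w x) (transpose v w y) → Link c u v x y
    back l = subst₂ (Link c u v) (transpose-inverse w v) (transpose-inverse w v)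
                    (link-transpose c u w≢u v≢u w≢c v≢c l)

  pendantStars-from-u : ∀ {b d} → b ≢ u → b ≢ v → b ≢ w → Dist Tv.T u b d → Dist Tw.T u b d
  pendantStars-from-u {b} {d} b≢u b≢v b≢w D =
    subst₂ (λ x y → Dist Tw.T x y d) (transpose-fixed (v≢u ∘ sym) (w≢u ∘ sym)) (transpose-fixed b≢v b≢w)
           (Dist-transport (Permutation.transpose v w) pendantStars-transpose D)

  pendantStars-consistent : ∀ {Q : SimpleGraph n} → adj Q u v ≡ false → adj Q u w ≡ false →
                            Consistent Q Tv.T Tw.T
  pendantStars-consistent {Q} uv∉Q uw∉Q a b ab∈Q d D with a ≟ u | b ≟ u
  ... | yes refl | yes refl = contradiction refl (edge⇒≢ Q ab∈Q)
  ... | yes refl | no b≢u   =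
    pendantStars-from-u b≢u (λ { refl → non-edge Q uv∉Q ab∈Q }) (λ { refl → non-edge Q uw∉Q ab∈Q }) D
  ... | no a≢u   | yes refl =
    Dist-sym (pendantStars-from-u a≢u (λ { refl → non-edge Q uv∉Q (edge-sym Q ab∈Q) })
                                      (λ { refl → non-edge Q uw∉Q (edge-sym Q ab∈Q) }) (Dist-sym D))
  ... | no a≢u   | no b≢u   = Dist-off-leaf Tv.u-leaf Tw.u-leaf pendantStars-agree-off-u a≢u b≢u D

identifying⇒non-neighbour-unique : ∀ {n} (Q : SimpleGraph n) → Identifying Q → 3 < n →
  ∀ {u v w} → v ≢ u → w ≢ u → adj Q u v ≡ false → adj Q u w ≡ false → v ≡ w
identifying⇒non-neighbour-unique Q identifying 3<n {u} {v} {w} v≢u w≢u uv∉Q uw∉Q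
  with c , c∉ ← fresh (u ∷ v ∷ w ∷ []) 3<n = Tw.u-leaf uv∈Tw
  where
  u≢c = c∉ ∘ here ∘ sym
  v≢c = c∉ ∘ there ∘ here ∘ sym
  w≢c = c∉ ∘ there ∘ there ∘ here ∘ sym
  module Tv = PendantStar c u v≢u v≢c u≢c
  module Tw = PendantStar c u w≢u w≢c u≢c
  uv∈Tw : Edge Tw.T u v
  uv∈Tw = trans (sym (identifying Tv.T Tw.T Tv.isTree Tw.isTree
                        (pendantStars-consistent v≢u w≢u v≢c w≢c u≢c {Q} uv∉Q uw∉Q) u v))
                (Tv.link-edge (inj₁ u↑t))

degree≥∸2 : ∀ {n} (G : SimpleGraph n) u →
            (∀ {v w} → v ≢ u → w ≢ u → adj G u v ≡ false → adj G u w ≡ false → v ≡ w) →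
            n ∸ 2 ≤ degree G u
degree≥∸2 {suc n} G u non-neighbour-unique = count≥∸2 (adj G u) u non-neighbour-unique

identifying⇒edgeCount≥ : ∀ {n} (Q : SimpleGraph n) → Identifying Q → 3 < n →
                         ⌈ n * (n ∸ 2) /2⌉ ≤ edgeCount Q
identifying⇒edgeCount≥ {n} Q identifying 3<n = begin
  ⌈ n * (n ∸ 2) /2⌉                  ≤⟨ ⌈n/2⌉-mono twice-bound ⟩
  ⌈ edgeCount Q + edgeCount Q /2⌉    ≡⟨ n≡⌈n+n/2⌉ (edgeCount Q) ⟨
  edgeCount Q                        ∎
  where
  open ≤-Reasoning
  twice-bound : n * (n ∸ 2) ≤ edgeCount Q + edgeCount Q
  twice-bound = begin
    n * (n ∸ 2)                ≡⟨ ∑-const n (n ∸ 2) ⟨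
    ∑[ u < n ] (n ∸ 2)         ≤⟨ ∑-mono-≤ (λ u → degree≥∸2 Q u non-neighbour-unique) ⟩
    ∑[ u < n ] degree Q u      ≡⟨ handshake Q ⟨
    edgeCount Q + edgeCount Q  ∎
    where non-neighbour-unique = identifying⇒non-neighbour-unique Q identifying 3<n

-- Upper bound

mate : ℕ → ℕ
mate 0             = 1
mate 1             = 0
mate (suc (suc k)) = suc (suc (mate k))

mate-involutive : ∀ k → mate (mate k) ≡ k
mate-involutive 0             = refl
mate-involutive 1             = refl
mate-involutive (suc (suc k)) = cong (2 +_) (mate-involutive k)

mate-≢ : ∀ k → mate k ≢ k
mate-≢ (suc (suc k)) eq = mate-≢ k (suc-injective (suc-injective eq))

mate≤suc : ∀ k → mate k ≤ suc k
mate≤suc 0             = s≤s z≤n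
mate≤suc 1             = z≤n
mate≤suc (suc (suc k)) = s≤s (s≤s (mate≤suc k))

module _ {n : ℕ} where

  Matched : Fin n → Fin n → Set
  Matched a b = toℕ b ≡ mate (toℕ a)

  Matched-sym : ∀ {a b} → Matched a b → Matched b a
  Matched-sym {a} eq = trans (sym (mate-involutive (toℕ a))) (cong mate (sym eq))

  Matched-functional : ∀ {a b c} → Matched a b → Matched a c → b ≡ c
  Matched-functional ab ac = toℕ-injective (trans ab (sym ac))

  Matched⇒≢ : ∀ {a b} → Matched a b → a ≢ b
  Matched⇒≢ {a} eq refl = mate-≢ (toℕ a) (sym eq)

  Unmatched : Fin n → Fin n → Set
  Unmatched a b = a ≢ b × ¬ Matched a b

  Unmatched-sym : ∀ {a b} → Unmatched a b → Unmatched b a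
  Unmatched-sym (a≢b , ¬ab) = a≢b ∘ sym , ¬ab ∘ Matched-sym

  Unmatched-irrefl : ∀ {a} → ¬ Unmatched a a
  Unmatched-irrefl (a≢a , _) = a≢a refl

  unmatched? : ∀ a b → Dec (Unmatched a b)
  unmatched? a b = ¬? (a ≟ b) ×-dec ¬? (toℕ b ≟ℕ mate (toℕ a))

-- The complete graph minus the matching {0,1}, {2,3}, … (which misses the last vertex when n is odd).
matchingComplement : ∀ n → SimpleGraph n
matchingComplement n = relationGraph Unmatched unmatched? Unmatched-sym Unmatched-irrefl

unmatched-edge : ∀ {n} {a b : Fin n} → Unmatched a b → Edge (matchingComplement n) a b
unmatched-edge = relationGraph-edge Unmatched unmatched? Unmatched-sym Unmatched-irrefl

matched-non-edge : ∀ {n} {a b : Fin n} → Matched a b → adj (matchingComplement n) a b ≡ false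
matched-non-edge ab =
  relationGraph-non-edge Unmatched unmatched? Unmatched-sym Unmatched-irrefl (λ (_ , ¬ab) → ¬ab ab)

unmatched⇒last : ∀ {m} (u : Fin (suc m)) → ¬ mate (toℕ u) < suc m → u ≡ fromℕ m
unmatched⇒last {m} u mate≮n = toℕ-injective (trans toℕu≡m (sym (toℕ-fromℕ m)))
  where
  toℕu≡m = ≤-antisym (≤-pred (toℕ<n u)) (≤-pred (≤-trans (≮⇒≥ mate≮n) (mate≤suc (toℕ u))))

matchingComplement-degree : ∀ {m} (u : Fin (suc m)) →
  degree (matchingComplement (suc m)) u ≤ indicator (does (u ≟ fromℕ m)) + (m ∸ 1)
matchingComplement-degree {m} u with mate (toℕ u) <? suc m
... | yes mate<n =
  ≤-trans (count≤∸2 (adj Q u) (Matched⇒≢ matched) (irrefl Q u) (matched-non-edge matched)) (m≤n+m (m ∸ 1) _)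
  where
  Q = matchingComplement (suc m)
  matched : Matched u (fromℕ< mate<n)
  matched = toℕ-fromℕ< mate<n
... | no mate≮n rewrite dec-true (u ≟ fromℕ m) (unmatched⇒last u mate≮n) =
  ≤-trans (count≤∸1 (adj Q u) (irrefl Q u)) (m≤n+m∸n m 1)
  where Q = matchingComplement (suc m)

matchingComplement-edgeCount : ∀ n → edgeCount (matchingComplement n) ≤ ⌈ n * (n ∸ 2) /2⌉
matchingComplement-edgeCount zero    = z≤n
matchingComplement-edgeCount (suc m) = begin
  E                               ≡⟨ n≡⌊n+n/2⌋ E ⟩
  ⌊ E + E /2⌋                     ≤⟨ ⌊n/2⌋-mono twice-bound ⟩
  ⌊ suc (suc m * (m ∸ 1)) /2⌋     ∎
  where
  open ≤-Reasoning
  E = edgeCount (matchingComplement (suc m))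
  isLast : Fin (suc m) → Bool
  isLast u = does (u ≟ fromℕ m)
  twice-bound : E + E ≤ suc (suc m * (m ∸ 1))
  twice-bound = begin
    E + E
      ≡⟨ handshake (matchingComplement (suc m)) ⟩
    ∑[ u < suc m ] degree (matchingComplement (suc m)) u
      ≤⟨ ∑-mono-≤ (matchingComplement-degree {m}) ⟩
    ∑[ u < suc m ] (indicator (isLast u) + (m ∸ 1))
      ≡⟨ ∑-distrib-+ (indicator ∘ isLast) (λ _ → m ∸ 1) ⟩
    count isLast + ∑[ u < suc m ] (m ∸ 1)
      ≡⟨ cong₂ _+_ (count-singleton (fromℕ m)) (∑-const (suc m) (m ∸ 1)) ⟩
    suc (suc m * (m ∸ 1))
      ∎

-- The 4-cycle s s′ q′ q: H contains all of its edges except q q′, and H′ all except s s′.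
record Square {n} (H H′ : SimpleGraph n) (s s′ q q′ : Fin n) : Set where
  field
    s≢s′    : s ≢ s′
    s≢q     : s ≢ q
    s≢q′    : s ≢ q′
    s′≢q    : s′ ≢ q
    s′≢q′   : s′ ≢ q′
    q≢q′    : q ≢ q′
    H-qs    : Edge H q s
    H-ss′   : Edge H s s′
    H-s′q′  : Edge H s′ q′
    H-q≁q′  : adj H q q′ ≡ false
    H′-sq   : Edge H′ s q
    H′-qq′  : Edge H′ q q′
    H′-q′s′ : Edge H′ q′ s′
    H′-s≁s′ : adj H′ s s′ ≡ false

module _ {n} {H H′ : SimpleGraph n} {s s′ q q′ : Fin n} (sq : Square H H′ s s′ q q′) where
  open Square sq

  Square-reverse : Square H H′ s′ s q′ q
  Square-reverse = record
    { s≢s′ = s≢s′ ∘ sym ; s≢q = s′≢q′ ; s≢q′ = s′≢q ; s′≢q = s≢q′ ; s′≢q′ = s≢q ; q≢q′ = q≢q′ ∘ sym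
    ; H-qs = edge-sym H H-s′q′ ; H-ss′ = edge-sym H H-ss′ ; H-s′q′ = edge-sym H H-qs
    ; H-q≁q′ = trans (SimpleGraph.sym H q′ q) H-q≁q′
    ; H′-sq = edge-sym H′ H′-q′s′ ; H′-qq′ = edge-sym H′ H′-qq′ ; H′-q′s′ = edge-sym H′ H′-sq
    ; H′-s≁s′ = trans (SimpleGraph.sym H′ s′ s) H′-s≁s′
    }

  Square-swap : Square H′ H q q′ s s′
  Square-swap = record
    { s≢s′ = q≢q′ ; s≢q = s≢q ∘ sym ; s≢q′ = s′≢q ∘ sym ; s′≢q = s≢q′ ∘ sym ; s′≢q′ = s′≢q′ ∘ sym ; q≢q′ = s≢s′
    ; H-qs = H′-sq ; H-ss′ = H′-qq′ ; H-s′q′ = H′-q′s′ ; H-q≁q′ = H′-s≁s′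
    ; H′-sq = H-qs ; H′-qq′ = H-ss′ ; H′-q′s′ = H-s′q′ ; H′-s≁s′ = H-q≁q′
    }

-- If x hangs from s in H, then d_H(x, s′) = 2 via s, while in H′ the path x s q q′ s′ rules this out.
square-no-outside-neighbour :
  ∀ {n} {Q H H′ : SimpleGraph n} {s s′ q q′ x} → Acyclic H → Acyclic H′ → Consistent Q H H′ →
  Square H H′ s s′ q q′ → x ≢ s → x ≢ s′ → x ≢ q → x ≢ q′ → Edge Q x s → Edge Q x s′ → ¬ Edge H x s
square-no-outside-neighbour {Q = Q} {H} {H′} {x = x}
  acyclic acyclic′ consistent sq x≢s x≢s′ x≢q x≢q′ xs∈Q xs′∈Q xs∈H =
  path₄⇒¬Dist₂ acyclic′ uniq xs∈H′ H′-sq H′-qq′ H′-q′s′ H′-s≁s′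
    (consistent x _ xs′∈Q 2 (path₂⇒Dist₂ acyclic x≢s′ xs∈H H-ss′))
  where
  open Square sq
  xs∈H′ = consistent⇒edge {Q = Q} {H} {H′} consistent xs∈Q xs∈H
  uniq = (x≢s ∷ x≢q ∷ x≢q′ ∷ x≢s′ ∷ []) ∷ (s≢q ∷ s≢q′ ∷ s≢s′ ∷ []) ∷ (q≢q′ ∷ s′≢q ∘ sym ∷ [])
       ∷ (s′≢q′ ∘ sym ∷ []) ∷ [] ∷ []

module Reconstruction {n} (4<n : 4 < n) {T T′ : SimpleGraph n} (T-tree : IsTree T) (T′-tree : IsTree T′)
  (consistent  : Consistent (matchingComplement n) T T′)
  (consistent′ : Consistent (matchingComplement n) T′ T) where

  open import Data.List.Membership.DecPropositional (_≟_ {n}) using (_∈?_)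

  private
    Q = matchingComplement n
    T-acyclic = proj₂ T-tree
    T′-acyclic = proj₂ T′-tree

  transfer : ∀ {a b} → Edge Q a b → Edge T a b → Edge T′ a b
  transfer = consistent⇒edge {Q = Q} {T} {T′} consistent

  transfer′ : ∀ {a b} → Edge Q a b → Edge T′ a b → Edge T a b
  transfer′ = consistent⇒edge {Q = Q} {T′} {T} consistent′

  unmatched-outside : ∀ {x a b} → Matched a b → x ≢ a → x ≢ b → Edge Q x a
  unmatched-outside ab x≢a x≢b =
    unmatched-edge (x≢a , λ xa → x≢b (Matched-functional (Matched-sym xa) ab))

  -- T′ reaches b from a through some p, and then back from p to b in two steps through some y.
  detour-square : ∀ {a b p} → Matched a b → Edge T a b → adj T′ a b ≡ false → Edge T′ a p →
                  ∃[ y ] Matched p y × Square T T′ a b p y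
  detour-square {a} {b} {p} ab Tab ab∉T′ T′ap =
    square-at (Dist-sym (consistent b p (edge-sym Q (unmatched-outside (Matched-sym ab) p≢b p≢a)) 2
                                    (path₂⇒Dist₂ T-acyclic (p≢b ∘ sym) (edge-sym T Tab) Tap)))
    where
    p≢a : p ≢ a
    p≢a = edge⇒≢ T′ T′ap ∘ sym
    p≢b : p ≢ b
    p≢b refl = non-edge T′ ab∉T′ T′ap
    Tap : Edge T a p
    Tap = transfer′ (edge-sym Q (unmatched-outside ab p≢a p≢b)) T′ap
    square-at : Dist T′ p b 2 → ∃[ y ] Matched p y × Square T T′ a b p y
    square-at (step {w = y} T′py (step T′yb here) , shortest) = y , py , square
      where
      y≢b : y ≢ b
      y≢b refl = <-irrefl refl (shortest 1 (step T′py here))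
      y≢a : y ≢ a
      y≢a refl = non-edge T′ ab∉T′ T′yb
      p≢y = edge⇒≢ T′ T′py
      Tyb : Edge T y b
      Tyb = transfer′ (unmatched-outside (Matched-sym ab) y≢b y≢a) T′yb
      p≁y : adj T p y ≡ false
      p≁y = ¬-not λ Tpy → no-quadrangle T-acyclic
        ((p≢a ∘ sym ∷ y≢a ∘ sym ∷ Matched⇒≢ ab ∷ []) ∷ (p≢y ∷ p≢b ∷ []) ∷ (y≢b ∷ []) ∷ [] ∷ [])
        Tap Tpy Tyb (edge-sym T Tab)
      py : Matched p y
      py = decidable-stable (toℕ y ≟ℕ mate (toℕ p)) λ ¬py →
        non-edge T p≁y (transfer′ (unmatched-edge (p≢y , ¬py)) T′py)
      square : Square T T′ a b p y
      square = record
        { s≢s′ = Matched⇒≢ ab ; s≢q = p≢a ∘ sym ; s≢q′ = y≢a ∘ sym ; s′≢q = p≢b ∘ sym ; s′≢q′ = y≢b ∘ sym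
        ; q≢q′ = p≢y
        ; H-qs = edge-sym T Tap ; H-ss′ = Tab ; H-s′q′ = edge-sym T Tyb ; H-q≁q′ = p≁y
        ; H′-sq = T′ap ; H′-qq′ = T′py ; H′-q′s′ = T′yb ; H′-s≁s′ = ab∉T′
        }

  lost-edge⇒square : ∀ {a b} → Matched a b → Edge T a b → adj T′ a b ≡ false →
                     ∃[ p ] ∃[ y ] Matched p y × Square T T′ a b p y
  lost-edge⇒square {a} {b} ab Tab ab∉T′ with proj₁ T′-tree a b
  ... | _ , here              = contradiction refl (Matched⇒≢ ab)
  ... | _ , step {w = p} T′ap _ = p , detour-square ab Tab ab∉T′ T′ap

  -- Since n ≥ 5 some vertex lies outside the square, so T joins some outside x to a square vertex s;
  -- whichever s it is, the square can be turned so that s plays the role of its first corner.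
  square-impossible : ∀ {a b p y} → Matched a b → Matched p y → ¬ Square T T′ a b p y
  square-impossible {a} {b} {p} {y} ab py sq with fresh (a ∷ b ∷ p ∷ y ∷ []) 4<n
  ... | z , z∉ with crossing-edge T (_∈ a ∷ b ∷ p ∷ y ∷ []) (_∈? a ∷ b ∷ p ∷ y ∷ [])
                                  (proj₂ (proj₁ T-tree z a)) z∉ (here refl)
  ... | x , s , x∉ , s∈ , Txs = attached s∈ Txs
    where
    x≢a = x∉ ∘ here
    x≢b = x∉ ∘ there ∘ here
    x≢p = x∉ ∘ there ∘ there ∘ here
    x≢y = x∉ ∘ there ∘ there ∘ there ∘ here
    xa∈Q = unmatched-outside ab x≢a x≢b
    xb∈Q = unmatched-outside (Matched-sym ab) x≢b x≢a
    xp∈Q = unmatched-outside py x≢p x≢y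
    xy∈Q = unmatched-outside (Matched-sym py) x≢y x≢p
    attached : ∀ {s} → s ∈ a ∷ b ∷ p ∷ y ∷ [] → ¬ Edge T x s
    attached (here refl) =
      square-no-outside-neighbour {Q = Q} T-acyclic T′-acyclic consistent sq
        x≢a x≢b x≢p x≢y xa∈Q xb∈Q
    attached (there (here refl)) =
      square-no-outside-neighbour {Q = Q} T-acyclic T′-acyclic consistent (Square-reverse sq)
        x≢b x≢a x≢y x≢p xb∈Q xa∈Q
    attached (there (there (here refl))) Txp =
      square-no-outside-neighbour {Q = Q} T′-acyclic T-acyclic consistent′ (Square-swap sq)
        x≢p x≢y x≢a x≢b xp∈Q xy∈Q (transfer xp∈Q Txp)
    attached (there (there (there (here refl)))) Txy =
      square-no-outside-neighbour {Q = Q} T′-acyclic T-acyclic consistent′ (Square-reverse (Square-swap sq))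
        x≢y x≢p x≢b x≢a xy∈Q xp∈Q (transfer xy∈Q Txy)

  edge-preserved : ∀ {a b} → Edge T a b → Edge T′ a b
  edge-preserved {a} {b} Tab with toℕ b ≟ℕ mate (toℕ a)
  ... | no ¬ab = transfer (unmatched-edge (edge⇒≢ T Tab , ¬ab)) Tab
  ... | yes ab = decidable-stable (adj T′ a b ≟ᵇ true) λ ab∉T′ →
    let (_ , _ , py , sq) = lost-edge⇒square ab Tab (¬-not ab∉T′) in square-impossible ab py sq

matchingComplement-identifying : ∀ {n} → 4 < n → Identifying (matchingComplement n)
matchingComplement-identifying 4<n T T′ T-tree T′-tree consistent a b =
  Bool-≡-from-⇔ (Reconstruction.edge-preserved 4<n T-tree T′-tree consistent consistent′)
                (Reconstruction.edge-preserved 4<n T′-tree T-tree consistent′ consistent)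
  where consistent′ = consistent-sym {Q = matchingComplement _} {T} {T′} (proj₁ T-tree) consistent

proposition1p6 : (n : ℕ) → 5 ≤ n →
    Σ (SimpleGraph n) (λ Q → Identifying Q × edgeCount Q ≡ ⌈ n * (n ∸ 2) /2⌉)
    × ((Q : SimpleGraph n) → Identifying Q → ⌈ n * (n ∸ 2) /2⌉ ≤ edgeCount Q)
proposition1p6 n 5≤n =
  ( matchingComplement n
  , identifying
  , ≤-antisym (matchingComplement-edgeCount n) (lower-bound (matchingComplement n) identifying) )
  , lower-bound
  where
  identifying = matchingComplement-identifying 5≤n
  lower-bound : (Q : SimpleGraph n) → Identifying Q → ⌈ n * (n ∸ 2) /2⌉ ≤ edgeCount Q
  lower-bound Q identifying-Q = identifying⇒edgeCount≥ Q identifying-Q (<⇒≤ 5≤n)
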